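{- If all inverse branches of $T$ have positive determinant (i.e., $T$ is increasing on each interval), then $\Sigma_T$ equals either $\Gamma=\mathrm{PSL}_2\mathbb{Z}$ or its unique index-$2$ subgroup $\langle R,SRS\rangle$. It equals $\Gamma$ iff at least one of the matrices $A_a$ factors in the free monoid $\mathcal{M}$ generated by $L,N$ as an $L$-$N$ product of odd length.
   Context: Here $L=\begin{bmatrix}1&0\\1&1\end{bmatrix}$, $N=\begin{bmatrix}1&1\\0&1\end{bmatrix}$, $S=\begin{bmatrix}0&-1\\1&0\end{bmatrix}$, $R=\begin{bmatrix}1&-1\\1&0\end{bmatrix}$ in $\mathrm{PGL}_2\mathbb{Z}$ (matrices up to sign); $\mathcal{M}$ is the free monoid on $L,N$, equal to the set of elements of $\mathrm{PSL}_2\mathbb{Z}$ with nonnegative entries. $T$ is a slow continued fraction algorithm on $[0,\infty]$ with inverse branches $A_0,\dots,A_{n-1}\in\mathrm{PGL}_2\mathbb{Z}$ (nonnegative entries, $A_a*[0,\infty]$ forming a unimodular partition of $[0,\infty]$ into at least two intervals, $T$ acting on $A_a*[0,\infty]$ by $A_a^{ -1}$), and $\Sigma_T=\langle A_0,\dots,A_{n-1}\rangle$. -}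

module Defs where

open import Data.Integer using (ℤ; +_; -_; _+_; _*_; _-_; _≤_; _≟_)
open import Data.Nat as ℕ using (ℕ)
open import Data.Bool using (Bool; true; false; if_then_else_)
open import Data.List using (List; []; _∷_; length; foldr)
open import Data.List.Membership.Propositional using (_∈_)
open import Data.List.Relation.Binary.Permutation.Propositional using (_↭_)
open import Data.Product using (Σ; ∃; _×_; _,_)
open import Data.Sum using (_⊎_)
open import Relation.Nullary using (does)
open import Relation.Binary.PropositionalEquality using (_≡_)

record Mat : Set where
  constructor mat
  field
    a b c d : ℤ
open Mat public

infixl 7 _·_
_·_ : Mat → Mat → Mat
mat a₁ b₁ c₁ d₁ · mat a₂ b₂ c₂ d₂ =
  mat (a₁ * a₂ + b₁ * c₂) (a₁ * b₂ + b₁ * d₂)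
      (c₁ * a₂ + d₁ * c₂) (c₁ * b₂ + d₁ * d₂)

det : Mat → ℤ
det (mat a b c d) = a * d - b * c

neg : Mat → Mat
neg (mat a b c d) = mat (- a) (- b) (- c) (- d)

-- adjugate: inverse for det 1, minus the inverse for det -1
-- (hence equal to the inverse in PGL₂ℤ for any det ±1 matrix)
adj : Mat → Mat
adj (mat a b c d) = mat d (- b) (- c) a

I Lm Nm Sm Rm : Mat
I  = mat (+ 1) (+ 0) (+ 0) (+ 1)
Lm = mat (+ 1) (+ 0) (+ 1) (+ 1)
Nm = mat (+ 1) (+ 1) (+ 0) (+ 1)
Sm = mat (+ 0) (- (+ 1)) (+ 1) (+ 0)
Rm = mat (+ 1) (- (+ 1)) (+ 1) (+ 0)

-- Subgroup of PGL₂ℤ generated by a list of (det ±1) matrices.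
-- Gen gs M  means: the class of M (up to sign) lies in ⟨gs⟩.
data Gen (gs : List Mat) : Mat → Set where
  gen-id  : Gen gs I
  gen-mul : ∀ {g M} → g ∈ gs → Gen gs M → Gen gs (g · M)
  gen-inv : ∀ {g M} → g ∈ gs → Gen gs M → Gen gs (adj g · M)
  gen-neg : ∀ {M} → Gen gs M → Gen gs (neg M)

_≐_ : (Mat → Set) → (Mat → Set) → Set
P ≐ Q = ∀ M → (P M → Q M) × (Q M → P M)

InPSL : Mat → Set
InPSL M = det M ≡ + 1

eval : List Bool → Mat
eval = foldr (λ x M → (if x then Lm else Nm) · M) I

Odd : ℕ → Set
Odd n = ∃ λ k → n ≡ ℕ.suc (2 ℕ.* k)

-- points of ℚ ∪ {∞} as integer pairs (p , q) meaning p/q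
Pt : Set
Pt = ℤ × ℤ

_≈ₚ_ : Pt → Pt → Set
(p , q) ≈ₚ (p' , q') = p * q' ≡ q * p'

zeroPt infPt : Pt
zeroPt = (+ 0 , + 1)
infPt  = (+ 1 , + 0)

at0 atInf : Mat → Pt
at0 M = (b M , d M)
atInf M = (a M , c M)

-- endpoints of the interval A * [0,∞] (A nonnegative, det ±1):
-- orientation preserving (det 1) gives [A*0 , A*∞], otherwise reversed
lo hi : Mat → Pt
lo M = if does (det M ≟ + 1) then at0 M else atInf M
hi M = if does (det M ≟ + 1) then atInf M else at0 M

-- the intervals of Bs, in this order, tile [x , ∞]
Tiles : Pt → List Mat → Set
Tiles x [] = x ≈ₚ infPt
Tiles x (B ∷ Bs) = (x ≈ₚ lo B) × Tiles (hi B) Bs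

NonNeg : Mat → Set
NonNeg M = (+ 0 ≤ a M) × (+ 0 ≤ b M) × (+ 0 ≤ c M) × (+ 0 ≤ d M)

IsUnit : Mat → Set
IsUnit M = (det M ≡ + 1) ⊎ (det M ≡ - (+ 1))

-- T is a slow continued fraction algorithm with inverse branches As:
-- nonnegative PGL₂ℤ matrices whose images of [0,∞] partition [0,∞]
-- (listed in some order Bs) into at least two intervals.
SlowCF : List Mat → Set
SlowCF As = (∀ {A} → A ∈ As → NonNeg A × IsUnit A)
          × Σ (List Mat) (λ Bs → (Bs ↭ As) × (2 ℕ.≤ length Bs) × Tiles zeroPt Bs)

ΣT : List Mat → Mat → Set
ΣT As = Gen As

-- Since every branch has positive determinant, each A lies in the monoid generated by L and N,
-- and the intervals A * [0 , ∞] are the leaves of a finite binary tree in which a node P has the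
-- children P L and P N (a finite subtree of the Stern–Brocot tree).  Two sibling leaves P L and
-- P N give X = L⁻¹N ∈ Σ_T, and walking up the tree gives S X S ∈ Σ_T as well, up to sign.  In
-- PSL₂ℤ these are (SRS)⁻¹ and R⁻¹, so Σ_T contains Γ² = ⟨R , SRS⟩, which contains every word of
-- even length in L and N.  Hence Σ_T = Γ² when every A is a word of even length, while a single A
-- of odd length puts L and N, and so all of Γ, into Σ_T.  Reduction mod 2 maps Γ² into the
-- subgroup of order 3 of SL₂(𝔽₂), which does not contain S; so Γ² ≠ Γ and the cases are exclusive.

{-# OPTIONS --safe #-}
module Submission where

open import Defs
open import Data.Nat as ℕ using (ℕ; zero; suc; s≤s)
import Data.Nat.Properties as ℕ
import Data.Nat.Tactic.RingSolver as ℕ-Solver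
open import Data.Nat.Divisibility using (_∣_; ∣-antisym; ∣-refl; _∣0; ∣1⇒≡1; ∣m+n∣m⇒∣n; n∣m*n; m∣m*n; ∣m⇒∣m*n; ∣n⇒∣m*n)
open import Data.Nat.Coprimality as Coprime using (Coprime; coprime-divisor)
open import Data.Integer using (ℤ; +_; -_; -[1+_]; _+_; _*_; _-_; ∣_∣; _/_; _%_; _>_; _<_; +≤+; _≟_; NonZero)
open import Data.Integer.Properties using (neg-involutive; abs-*; *-identityʳ; pos-*; +-injective)
open import Data.Integer.DivMod using (a≡a%n+[a/n]*n; n%d<d)
open import Data.Integer.Tactic.RingSolver using (solve-∀)
open import Data.Bool using (Bool; true; false; if_then_else_)
open import Data.List using (List; []; _∷_; [_]; map; _++_; length)
open import Data.List.Properties using (map-++; map-∘; length-map; length-++)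
open import Data.List.Membership.Propositional using (_∈_; find; lose)
open import Data.List.Membership.Propositional.Properties using (∈-map⁺; ∈-map⁻; ∈-++⁺ˡ; ∈-++⁺ʳ)
open import Data.List.Relation.Unary.All as All using (All; []; _∷_)
open import Data.List.Relation.Unary.Any using (Any; here; there)
open import Data.List.Relation.Binary.Permutation.Propositional using (_↭_; ↭-sym)
open import Data.List.Relation.Binary.Permutation.Propositional.Properties using (∈-resp-↭)
open import Data.Product using (Σ; _×_; _,_; proj₁; proj₂)
open import Data.Sum using (_⊎_; inj₁; inj₂)
open import Data.Empty using (⊥-elim)
open import Function using (_∘_)
open import Relation.Nullary using (¬_; yes; no)
open import Relation.Unary using (_⊆_)
open import Relation.Binary.PropositionalEquality
  using (_≡_; _≢_; refl; sym; trans; cong; cong₂; subst; subst₂; module ≡-Reasoning)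

-- 2 × 2 integer matrices

mat-cong : ∀ {a b c d a′ b′ c′ d′} →
           a ≡ a′ → b ≡ b′ → c ≡ c′ → d ≡ d′ → mat a b c d ≡ mat a′ b′ c′ d′
mat-cong refl refl refl refl = refl

·-assoc : ∀ A B C → (A · B) · C ≡ A · (B · C)
·-assoc (mat a₁ b₁ c₁ d₁) (mat a₂ b₂ c₂ d₂) (mat a₃ b₃ c₃ d₃) =
  mat-cong (entry a₁ b₁ a₃ c₃) (entry a₁ b₁ b₃ d₃) (entry c₁ d₁ a₃ c₃) (entry c₁ d₁ b₃ d₃)
  where
  expand : ∀ x y a b c d z w → (x * a + y * c) * z + (x * b + y * d) * w
                             ≡ x * (a * z + b * w) + y * (c * z + d * w)
  expand = solve-∀
  entry : ∀ x y z w → (x * a₂ + y * c₂) * z + (x * b₂ + y * d₂) * w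
                    ≡ x * (a₂ * z + b₂ * w) + y * (c₂ * z + d₂ * w)
  entry x y = expand x y a₂ b₂ c₂ d₂

·-identityˡ : ∀ M → I · M ≡ M
·-identityˡ (mat a b c d) = mat-cong (first a c) (first b d) (second a c) (second b d)
  where
  first : ∀ x y → + 1 * x + + 0 * y ≡ x
  first = solve-∀
  second : ∀ x y → + 0 * x + + 1 * y ≡ y
  second = solve-∀

·-identityʳ : ∀ M → M · I ≡ M
·-identityʳ (mat a b c d) = mat-cong (first a b) (second a b) (first c d) (second c d)
  where
  first : ∀ x y → x * + 1 + y * + 0 ≡ x
  first = solve-∀
  second : ∀ x y → x * + 0 + y * + 1 ≡ y
  second = solve-∀

neg-distribˡ-· : ∀ A B → neg A · B ≡ neg (A · B)
neg-distribˡ-· (mat a₁ b₁ c₁ d₁) (mat a₂ b₂ c₂ d₂) =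
  mat-cong (entry a₁ b₁ a₂ c₂) (entry a₁ b₁ b₂ d₂) (entry c₁ d₁ a₂ c₂) (entry c₁ d₁ b₂ d₂)
  where
  entry : ∀ x y z w → - x * z + - y * w ≡ - (x * z + y * w)
  entry = solve-∀

adj-involutive : ∀ M → adj (adj M) ≡ M
adj-involutive (mat a b c d) = mat-cong refl (neg-involutive b) (neg-involutive c) refl

adj-anti-· : ∀ A B → adj (A · B) ≡ adj B · adj A
adj-anti-· (mat a₁ b₁ c₁ d₁) (mat a₂ b₂ c₂ d₂) =
  mat-cong (entry₁ c₁ b₂ d₁ d₂) (entry₂ a₁ b₂ b₁ d₂) (entry₃ c₁ a₂ d₁ c₂) (entry₄ a₁ a₂ b₁ c₂)
  where
  entry₁ : ∀ x z y w → x * z + y * w ≡ w * y + - z * - x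
  entry₁ = solve-∀
  entry₂ : ∀ x z y w → - (x * z + y * w) ≡ w * - y + - z * x
  entry₂ = solve-∀
  entry₃ : ∀ x z y w → - (x * z + y * w) ≡ - w * y + z * - x
  entry₃ = solve-∀
  entry₄ : ∀ x z y w → x * z + y * w ≡ - w * - y + z * x
  entry₄ = solve-∀

adj-neg : ∀ M → adj (neg M) ≡ neg (adj M)
adj-neg (mat a b c d) = refl

det-· : ∀ A B → det (A · B) ≡ det A * det B
det-· (mat a₁ b₁ c₁ d₁) (mat a₂ b₂ c₂ d₂) = expand a₁ b₁ c₁ d₁ a₂ b₂ c₂ d₂
  where
  expand : ∀ a₁ b₁ c₁ d₁ a₂ b₂ c₂ d₂ →
           (a₁ * a₂ + b₁ * c₂) * (c₁ * b₂ + d₁ * d₂) - (a₁ * b₂ + b₁ * d₂) * (c₁ * a₂ + d₁ * c₂)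
           ≡ (a₁ * d₁ - b₁ * c₁) * (a₂ * d₂ - b₂ * c₂)
  expand = solve-∀

det-adj : ∀ M → det (adj M) ≡ det M
det-adj (mat a b c d) = expand a b c d
  where
  expand : ∀ a b c d → d * a - - b * - c ≡ a * d - b * c
  expand = solve-∀

det-neg : ∀ M → det (neg M) ≡ det M
det-neg (mat a b c d) = expand a b c d
  where
  expand : ∀ a b c d → - a * - d - - b * - c ≡ a * d - b * c
  expand = solve-∀

adj-inverseˡ : ∀ M → det M ≡ + 1 → adj M · M ≡ I
adj-inverseˡ (mat a b c d) det≡1 =
  mat-cong (trans (diagonal₁ a b c d) det≡1) (off b d) (off′ a c) (trans (diagonal₂ a b c d) det≡1)
  where
  diagonal₁ : ∀ a b c d → d * a + - b * c ≡ a * d - b * c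
  diagonal₁ = solve-∀
  diagonal₂ : ∀ a b c d → - c * b + a * d ≡ a * d - b * c
  diagonal₂ = solve-∀
  off : ∀ x y → y * x + - x * y ≡ + 0
  off = solve-∀
  off′ : ∀ x y → - y * x + x * y ≡ + 0
  off′ = solve-∀

adj-inverseʳ : ∀ M → det M ≡ + 1 → M · adj M ≡ I
adj-inverseʳ M det≡1 = begin
  M · adj M             ≡⟨ cong (_· adj M) (adj-involutive M) ⟨
  adj (adj M) · adj M   ≡⟨ adj-inverseˡ (adj M) (trans (det-adj M) det≡1) ⟩
  I                     ∎
  where open ≡-Reasoning

adj-cancelˡ : ∀ P M → det P ≡ + 1 → adj P · (P · M) ≡ M
adj-cancelˡ P M det≡1 = begin
  adj P · (P · M)   ≡⟨ ·-assoc (adj P) P M ⟨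
  (adj P · P) · M   ≡⟨ cong (_· M) (adj-inverseˡ P det≡1) ⟩
  I · M             ≡⟨ ·-identityˡ M ⟩
  M                 ∎
  where open ≡-Reasoning

left-quotient-invariant : ∀ P A B → det P ≡ + 1 → adj (P · A) · (P · B) ≡ adj A · B
left-quotient-invariant P A B det≡1 = begin
  adj (P · A) · (P · B)       ≡⟨ cong (_· (P · B)) (adj-anti-· P A) ⟩
  (adj A · adj P) · (P · B)   ≡⟨ ·-assoc (adj A) (adj P) (P · B) ⟩
  adj A · (adj P · (P · B))   ≡⟨ cong (adj A ·_) (adj-cancelˡ P B det≡1) ⟩
  adj A · B                   ∎
  where open ≡-Reasoning

Lm·-expand : ∀ x y z w → mat x y (x + z) (y + w) ≡ Lm · mat x y z w
Lm·-expand x y z w = mat-cong (keep x z) (keep y w) (add x z) (add y w)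
  where
  keep : ∀ x z → x ≡ + 1 * x + + 0 * z
  keep = solve-∀
  add : ∀ x z → x + z ≡ + 1 * x + + 1 * z
  add = solve-∀

Nm·-expand : ∀ x y z w → mat (x + z) (y + w) z w ≡ Nm · mat x y z w
Nm·-expand x y z w = mat-cong (add x z) (add y w) (keep x z) (keep y w)
  where
  keep : ∀ x z → z ≡ + 0 * x + + 1 * z
  keep = solve-∀
  add : ∀ x z → x + z ≡ + 1 * x + + 1 * z
  add = solve-∀


-- Subgroups generated by a list of matrices

module _ {gs : List Mat} where

  private
    G : Mat → Set
    G = Gen gs

  gen-generator : ∀ {g} → g ∈ gs → G g
  gen-generator {g} g∈gs = subst G (·-identityʳ g) (gen-mul g∈gs gen-id)

  gen-· : ∀ {A B} → G A → G B → G (A · B)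
  gen-· {B = B} gen-id        q = subst G (sym (·-identityˡ B)) q
  gen-· {B = B} (gen-mul {g} {M} g∈gs p) q =
    subst G (sym (·-assoc g M B)) (gen-mul g∈gs (gen-· p q))
  gen-· {B = B} (gen-inv {g} {M} g∈gs p) q =
    subst G (sym (·-assoc (adj g) M B)) (gen-inv g∈gs (gen-· p q))
  gen-· {B = B} (gen-neg {M} p) q = subst G (sym (neg-distribˡ-· M B)) (gen-neg (gen-· p q))

  gen-adj : ∀ {A} → G A → G (adj A)
  gen-adj gen-id = gen-id
  gen-adj (gen-mul {g} {M} g∈gs p) =
    subst G (sym (adj-anti-· g M)) (gen-· (gen-adj p) (subst G (·-identityʳ (adj g)) (gen-inv g∈gs gen-id)))
  gen-adj (gen-inv {g} {M} g∈gs p) =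
    subst G (sym (trans (adj-anti-· (adj g) M) (cong (adj M ·_) (adj-involutive g))))
          (gen-· (gen-adj p) (gen-generator g∈gs))
  gen-adj (gen-neg {M} p) = subst G (sym (adj-neg M)) (gen-neg (gen-adj p))

  gen-det : (∀ {g} → g ∈ gs → det g ≡ + 1) → G ⊆ InPSL
  gen-det unimodular gen-id = refl
  gen-det unimodular (gen-mul {g} {M} g∈gs p) =
    trans (det-· g M) (cong₂ _*_ (unimodular g∈gs) (gen-det unimodular p))
  gen-det unimodular (gen-inv {g} {M} g∈gs p) =
    trans (det-· (adj g) M) (cong₂ _*_ (trans (det-adj g) (unimodular g∈gs)) (gen-det unimodular p))
  gen-det unimodular (gen-neg {M} p) = trans (det-neg M) (gen-det unimodular p)

gen-mono : ∀ {gs hs} → (∀ {g} → g ∈ gs → Gen hs g) → Gen gs ⊆ Gen hs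
gen-mono sub gen-id = gen-id
gen-mono sub (gen-mul g∈gs p) = gen-· (sub g∈gs) (gen-mono sub p)
gen-mono sub (gen-inv g∈gs p) = gen-· (gen-adj (sub g∈gs)) (gen-mono sub p)
gen-mono sub (gen-neg p) = gen-neg (gen-mono sub p)

-- L and N generate PSL₂ℤ

*≡1⇒±1 : ∀ i j → i * j ≡ + 1 → (i ≡ + 1 × j ≡ + 1) ⊎ (i ≡ - + 1 × j ≡ - + 1)
*≡1⇒±1 i j ij≡1 with ℕ.m*n≡1⇒m≡1 ∣ i ∣ ∣ j ∣ ∣ij∣≡1 | ℕ.m*n≡1⇒n≡1 ∣ i ∣ ∣ j ∣ ∣ij∣≡1
  where ∣ij∣≡1 = trans (sym (abs-* i j)) (cong ∣_∣ ij≡1)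
*≡1⇒±1 (+ .1)    (+ .1)    _  | refl | refl = inj₁ (refl , refl)
*≡1⇒±1 (+ .1)    -[1+ .0 ] () | refl | refl
*≡1⇒±1 -[1+ .0 ] (+ .1)    () | refl | refl
*≡1⇒±1 -[1+ .0 ] -[1+ .0 ] _  | refl | refl = inj₂ (refl , refl)

Nᶻ : ℤ → Mat
Nᶻ k = mat (+ 1) k (+ 0) (+ 1)

Nm·Nᶻ : ∀ k → Nm · Nᶻ k ≡ Nᶻ (+ 1 + k)
Nm·Nᶻ k = mat-cong refl (sym (top k)) refl (sym (bottom k))
  where
  top : ∀ k → + 1 + k ≡ + 1 * k + + 1 * + 1
  top = solve-∀
  bottom : ∀ k → + 1 ≡ + 0 * k + + 1 * + 1
  bottom = solve-∀

adjNm·Nᶻ : ∀ k → adj Nm · Nᶻ k ≡ Nᶻ (- + 1 + k)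
adjNm·Nᶻ k = mat-cong refl (sym (top k)) refl (sym (bottom k))
  where
  top : ∀ k → - + 1 + k ≡ + 1 * k + - + 1 * + 1
  top = solve-∀
  bottom : ∀ k → + 1 ≡ + 0 * k + + 1 * + 1
  bottom = solve-∀

det-Nᶻ : ∀ k → det (Nᶻ k) ≡ + 1
det-Nᶻ k = expand k
  where
  expand : ∀ k → + 1 * + 1 - k * + 0 ≡ + 1
  expand = solve-∀

Nᶻ-cancel : ∀ k M → Nᶻ k · (Nᶻ (- k) · M) ≡ M
Nᶻ-cancel k (mat a b c d) = sym (mat-cong (top k a c) (top k b d) (bottom k a c) (bottom k b d))
  where
  top : ∀ k x y → x ≡ + 1 * (+ 1 * x + - k * y) + k * (+ 0 * x + + 1 * y)
  top = solve-∀
  bottom : ∀ k x y → y ≡ + 0 * (+ 1 * x + - k * y) + + 1 * (+ 0 * x + + 1 * y)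
  bottom = solve-∀

det-upper-triangular : ∀ a b d → a * d - b * + 0 ≡ a * d
det-upper-triangular = solve-∀

module _ {gs : List Mat} (L∈G : Gen gs Lm) (N∈G : Gen gs Nm) where

  private
    G : Mat → Set
    G = Gen gs

  Nᶻ∈G : ∀ k → G (Nᶻ k)
  Nᶻ∈G (+ zero)          = gen-id
  Nᶻ∈G (+ suc n)         = subst G (Nm·Nᶻ (+ n)) (gen-· N∈G (Nᶻ∈G (+ n)))
  Nᶻ∈G -[1+ zero ]       = subst G (adjNm·Nᶻ (+ 0)) (gen-· (gen-adj N∈G) gen-id)
  Nᶻ∈G -[1+ suc n ]      = subst G (adjNm·Nᶻ -[1+ n ]) (gen-· (gen-adj N∈G) (Nᶻ∈G -[1+ n ]))

  S∈G : G Sm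
  S∈G = gen-· L∈G (gen-· (gen-adj N∈G) L∈G)

  -- Euclid's algorithm: S Nᶻ(-⌊a/c⌋) sends the first column (a , c) to (-c , a mod c),
  -- so |c| decreases; n is fuel bounding |c|.
  private
    euclid : ∀ n M → ∣ c M ∣ ℕ.< n → det M ≡ + 1 → G M
    euclid-step : ∀ n M → .{{_ : NonZero (c M)}} → ∣ c M ∣ ℕ.< suc n → det M ≡ + 1 → G M

    euclid (suc n) (mat a b (+ zero) d) _ det≡1 with *≡1⇒±1 a d (trans (sym (det-upper-triangular a b d)) det≡1)
    ... | inj₁ (refl , refl) = Nᶻ∈G b
    ... | inj₂ (refl , refl) = subst G (mat-cong refl (neg-involutive b) refl refl) (gen-neg (Nᶻ∈G (- b)))
    euclid (suc n) M@(mat a b c@(+ suc _) d) |c|<n det≡1 = euclid-step n M |c|<n det≡1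
    euclid (suc n) M@(mat a b c@(-[1+ _ ]) d) |c|<n det≡1 = euclid-step n M |c|<n det≡1

    euclid-step n M@(mat a b c d) |c|<1+n det≡1 =
      subst G M≡ (gen-· (Nᶻ∈G q) (gen-· (gen-adj S∈G) (euclid n M′ |c′|<n det′≡1)))
      where
      q = a / c
      M′ = Sm · (Nᶻ (- q) · M)
      c′≡a%c : Mat.c M′ ≡ + (a % c)
      c′≡a%c = trans (first-column q a c) (trans (cong (λ z → z - q * c) (a≡a%n+[a/n]*n a c)) (cancel (+ (a % c)) q c))
        where
        first-column : ∀ q a c → + 1 * (+ 1 * a + - q * c) + + 0 * (+ 0 * a + + 1 * c) ≡ a - q * c
        first-column = solve-∀
        cancel : ∀ x q c → (x + q * c) - q * c ≡ x
        cancel = solve-∀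
      |c′|<n : ∣ Mat.c M′ ∣ ℕ.< n
      |c′|<n = subst (ℕ._< n) (sym (cong ∣_∣ c′≡a%c)) (ℕ.<-≤-trans (n%d<d a c) (ℕ.s≤s⁻¹ |c|<1+n))
      det′≡1 : det M′ ≡ + 1
      det′≡1 = trans (det-· Sm (Nᶻ (- q) · M))
                     (cong (+ 1 *_) (trans (det-· (Nᶻ (- q)) M) (cong₂ _*_ (det-Nᶻ (- q)) det≡1)))
      M≡ : Nᶻ q · (adj Sm · M′) ≡ M
      M≡ = trans (cong (Nᶻ q ·_) (adj-cancelˡ Sm (Nᶻ (- q) · M) refl)) (Nᶻ-cancel q M)

  PSL⊆⟨L,N⟩ : InPSL ⊆ G
  PSL⊆⟨L,N⟩ {M} = euclid (suc ∣ c M ∣) M ℕ.≤-refl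

-- Congruences and reduction mod 2

infix 4 _≡_mod_ _≡ᴹ_mod_

record _≡_mod_ (x y m : ℤ) : Set where
  constructor by-quotient
  field
    quotient : ℤ
    difference : x ≡ y + quotient * m

module _ {m : ℤ} where

  ≡-mod-refl : ∀ {x} → x ≡ x mod m
  ≡-mod-refl {x} = by-quotient (+ 0) (expand x m)
    where
    expand : ∀ x m → x ≡ x + + 0 * m
    expand = solve-∀

  ≡-mod-trans : ∀ {x y z} → x ≡ y mod m → y ≡ z mod m → x ≡ z mod m
  ≡-mod-trans {z = z} (by-quotient k refl) (by-quotient l refl) = by-quotient (k + l) (expand z k l m)
    where
    expand : ∀ z k l m → (z + l * m) + k * m ≡ z + (k + l) * m
    expand = solve-∀

  +-cong-mod : ∀ {x x′ y y′} → x ≡ x′ mod m → y ≡ y′ mod m → x + y ≡ x′ + y′ mod m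
  +-cong-mod {x′ = x′} {y′ = y′} (by-quotient k refl) (by-quotient l refl) =
    by-quotient (k + l) (expand x′ y′ k l m)
    where
    expand : ∀ x y k l m → (x + k * m) + (y + l * m) ≡ (x + y) + (k + l) * m
    expand = solve-∀

  *-cong-mod : ∀ {x x′ y y′} → x ≡ x′ mod m → y ≡ y′ mod m → x * y ≡ x′ * y′ mod m
  *-cong-mod {x′ = x′} {y′ = y′} (by-quotient k refl) (by-quotient l refl) =
    by-quotient (x′ * l + k * y′ + k * l * m) (expand x′ y′ k l m)
    where
    expand : ∀ x y k l m → (x + k * m) * (y + l * m) ≡ x * y + (x * l + k * y + k * l * m) * m
    expand = solve-∀

  neg-cong-mod : ∀ {x x′} → x ≡ x′ mod m → - x ≡ - x′ mod m
  neg-cong-mod {x′ = x′} (by-quotient k refl) = by-quotient (- k) (expand x′ k m)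
    where
    expand : ∀ x k m → - (x + k * m) ≡ - x + - k * m
    expand = solve-∀

record _≡ᴹ_mod_ (M P : Mat) (m : ℤ) : Set where
  constructor entrywise
  field
    a≡ : a M ≡ a P mod m
    b≡ : b M ≡ b P mod m
    c≡ : c M ≡ c P mod m
    d≡ : d M ≡ d P mod m

module _ {m : ℤ} where

  ≡ᴹ-mod-refl : ∀ {M} → M ≡ᴹ M mod m
  ≡ᴹ-mod-refl = entrywise ≡-mod-refl ≡-mod-refl ≡-mod-refl ≡-mod-refl

  ≡ᴹ-mod-trans : ∀ {A B C} → A ≡ᴹ B mod m → B ≡ᴹ C mod m → A ≡ᴹ C mod m
  ≡ᴹ-mod-trans (entrywise x₁ x₂ x₃ x₄) (entrywise y₁ y₂ y₃ y₄) =
    entrywise (≡-mod-trans x₁ y₁) (≡-mod-trans x₂ y₂) (≡-mod-trans x₃ y₃) (≡-mod-trans x₄ y₄)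

  ·-cong-mod : ∀ {A A′ B B′} → A ≡ᴹ A′ mod m → B ≡ᴹ B′ mod m → A · B ≡ᴹ A′ · B′ mod m
  ·-cong-mod {mat _ _ _ _} {mat _ _ _ _} {mat _ _ _ _} {mat _ _ _ _}
             (entrywise a₁ b₁ c₁ d₁) (entrywise a₂ b₂ c₂ d₂) =
    entrywise (row-col a₁ b₁ a₂ c₂) (row-col a₁ b₁ b₂ d₂) (row-col c₁ d₁ a₂ c₂) (row-col c₁ d₁ b₂ d₂)
    where
    row-col : ∀ {x x′ y y′ z z′ w w′} → x ≡ x′ mod m → y ≡ y′ mod m → z ≡ z′ mod m → w ≡ w′ mod m →
              x * z + y * w ≡ x′ * z′ + y′ * w′ mod m
    row-col x≡ y≡ z≡ w≡ = +-cong-mod (*-cong-mod x≡ z≡) (*-cong-mod y≡ w≡)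

  neg-cong-modᴹ : ∀ {A A′} → A ≡ᴹ A′ mod m → neg A ≡ᴹ neg A′ mod m
  neg-cong-modᴹ {mat _ _ _ _} {mat _ _ _ _} (entrywise a≡ b≡ c≡ d≡) =
    entrywise (neg-cong-mod a≡) (neg-cong-mod b≡) (neg-cong-mod c≡) (neg-cong-mod d≡)

module _ (m : ℤ) .{{_ : NonZero m}} where

  reduce : Mat → Mat
  reduce (mat a b c d) = mat (+ (a % m)) (+ (b % m)) (+ (c % m)) (+ (d % m))

  reduce-correct : ∀ M → M ≡ᴹ reduce M mod m
  reduce-correct (mat a b c d) = entrywise (≡-mod-% a) (≡-mod-% b) (≡-mod-% c) (≡-mod-% d)
    where
    ≡-mod-% : ∀ x → x ≡ + (x % m) mod m
    ≡-mod-% x = by-quotient (x / m) (a≡a%n+[a/n]*n x m)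

Γ² : Mat → Set
Γ² = Gen (Rm ∷ Sm · Rm · Sm ∷ [])

-- R and R² reduced mod 2; with I they form the subgroup of order 3 of SL₂(𝔽₂), which misses S.
R₂ R₂² : Mat
R₂  = mat (+ 1) (+ 1) (+ 1) (+ 0)
R₂² = mat (+ 0) (+ 1) (+ 1) (+ 1)

data RotationMod2 (M : Mat) : Set where
  ≡I  : M ≡ᴹ I mod + 2 → RotationMod2 M
  ≡R  : M ≡ᴹ R₂ mod + 2 → RotationMod2 M
  ≡R² : M ≡ᴹ R₂² mod + 2 → RotationMod2 M

private
  ·-reduce : ∀ {g g′ M P} → g ≡ᴹ g′ mod + 2 → M ≡ᴹ P mod + 2 → g · M ≡ᴹ reduce (+ 2) (g′ · P) mod + 2
  ·-reduce g≡ M≡ = ≡ᴹ-mod-trans (·-cong-mod g≡ M≡) (reduce-correct (+ 2) _)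

rotate : ∀ {g M} → g ≡ᴹ R₂ mod + 2 → RotationMod2 M → RotationMod2 (g · M)
rotate g≡R (≡I M≡)  = ≡R  (·-reduce g≡R M≡)
rotate g≡R (≡R M≡)  = ≡R² (·-reduce g≡R M≡)
rotate g≡R (≡R² M≡) = ≡I  (·-reduce g≡R M≡)

rotate⁻¹ : ∀ {g M} → g ≡ᴹ R₂² mod + 2 → RotationMod2 M → RotationMod2 (g · M)
rotate⁻¹ g≡R² (≡I M≡)  = ≡R² (·-reduce g≡R² M≡)
rotate⁻¹ g≡R² (≡R M≡)  = ≡I  (·-reduce g≡R² M≡)
rotate⁻¹ g≡R² (≡R² M≡) = ≡R  (·-reduce g≡R² M≡)

rotation-neg : ∀ {M} → RotationMod2 M → RotationMod2 (neg M)
rotation-neg (≡I M≡)  = ≡I  (≡ᴹ-mod-trans (neg-cong-modᴹ M≡) (reduce-correct (+ 2) _))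
rotation-neg (≡R M≡)  = ≡R  (≡ᴹ-mod-trans (neg-cong-modᴹ M≡) (reduce-correct (+ 2) _))
rotation-neg (≡R² M≡) = ≡R² (≡ᴹ-mod-trans (neg-cong-modᴹ M≡) (reduce-correct (+ 2) _))

Γ²⇒RotationMod2 : ∀ {M} → Γ² M → RotationMod2 M
Γ²⇒RotationMod2 gen-id = ≡I ≡ᴹ-mod-refl
Γ²⇒RotationMod2 (gen-mul (here refl) p)         = rotate (reduce-correct (+ 2) Rm) (Γ²⇒RotationMod2 p)
Γ²⇒RotationMod2 (gen-mul (there (here refl)) p) = rotate⁻¹ (reduce-correct (+ 2) (Sm · Rm · Sm)) (Γ²⇒RotationMod2 p)
Γ²⇒RotationMod2 (gen-inv (here refl) p)         = rotate⁻¹ (reduce-correct (+ 2) (adj Rm)) (Γ²⇒RotationMod2 p)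
Γ²⇒RotationMod2 (gen-inv (there (here refl)) p) = rotate (reduce-correct (+ 2) (adj (Sm · Rm · Sm))) (Γ²⇒RotationMod2 p)
Γ²⇒RotationMod2 (gen-neg p) = rotation-neg (Γ²⇒RotationMod2 p)

0≢1-mod-2 : ¬ (+ 0 ≡ + 1 mod + 2)
0≢1-mod-2 (by-quotient k 0≡1+2k) = no-half ∣ k ∣ (trans (sym (abs-* k (+ 2))) (cong ∣_∣ (solve-for-k k 0≡1+2k)))
  where
  solve-for-k : ∀ k → + 0 ≡ + 1 + k * + 2 → k * + 2 ≡ - + 1
  solve-for-k k eq = trans (expand k) (cong (_- + 1) (sym eq))
    where
    expand : ∀ k → k * + 2 ≡ (+ 1 + k * + 2) - + 1
    expand = solve-∀
  no-half : ∀ n → n ℕ.* 2 ≢ 1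
  no-half zero ()
  no-half (suc n) ()

S∉Γ² : ¬ Γ² Sm
S∉Γ² S∈Γ² with Γ²⇒RotationMod2 S∈Γ²
... | ≡I  S≡ = 0≢1-mod-2 (_≡ᴹ_mod_.a≡ S≡)
... | ≡R  S≡ = 0≢1-mod-2 (_≡ᴹ_mod_.a≡ S≡)
... | ≡R² S≡ = 0≢1-mod-2 (_≡ᴹ_mod_.d≡ S≡)

-- Words in L and N

letter : Bool → Mat
letter x = if x then Lm else Nm

data EvenWord : List Bool → Set where
  []   : EvenWord []
  pair : ∀ x y {w} → EvenWord w → EvenWord (x ∷ y ∷ w)

even-length⇒EvenWord : ∀ k (w : List Bool) → length w ≡ 2 ℕ.* k → EvenWord w
even-length⇒EvenWord zero    []          _     = []
even-length⇒EvenWord (suc k) (x ∷ [])    |w|≡ = ⊥-elim (ℕ.0≢1+n (trans (cong ℕ.pred |w|≡) (ℕ.+-suc k (k ℕ.+ 0))))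
even-length⇒EvenWord (suc k) (x ∷ y ∷ w) |w|≡ =
  pair x y (even-length⇒EvenWord k w (ℕ.suc-injective (trans (ℕ.suc-injective |w|≡) (ℕ.+-suc k (k ℕ.+ 0)))))

odd-length-split : ∀ {w} → Odd (length w) → Σ Bool λ x → Σ (List Bool) λ w′ → w ≡ x ∷ w′ × EvenWord w′
odd-length-split {x ∷ w} (k , |w|≡) = x , w , refl , even-length⇒EvenWord k w (ℕ.suc-injective |w|≡)

odd-or-even : ∀ w → Odd (length w) ⊎ EvenWord w
odd-or-even []          = inj₂ []
odd-or-even (x ∷ [])    = inj₁ (0 , refl)
odd-or-even (x ∷ y ∷ w) with odd-or-even w
... | inj₁ (k , |w|≡) = inj₁ (suc k , cong (suc ∘ suc) (trans |w|≡ (sym (ℕ.+-suc k (k ℕ.+ 0)))))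
... | inj₂ even       = inj₂ (pair x y even)

-- X = L⁻¹N; up to sign, X = (SRS)⁻¹ and SXS = R⁻¹.
Xm SXS : Mat
Xm  = mat (+ 1) (+ 1) (- + 1) (+ 0)
SXS = Sm · Xm · Sm

module _ {gs : List Mat} where

  private
    G : Mat → Set
    G = Gen gs

  Γ²⊆ : G Xm → G SXS → Γ² ⊆ G
  Γ²⊆ X∈G SXS∈G = gen-mono λ where
    (here refl)         → gen-neg (gen-adj SXS∈G)
    (there (here refl)) → gen-neg (gen-adj X∈G)

X∈Γ² : Γ² Xm
X∈Γ² = gen-neg (gen-adj (gen-generator (there (here refl))))

SXS∈Γ² : Γ² SXS
SXS∈Γ² = gen-neg (gen-adj (gen-generator (here refl)))

Γ²⊆PSL : Γ² ⊆ InPSL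
Γ²⊆PSL = gen-det λ where
  (here refl)         → refl
  (there (here refl)) → refl

letter-pair∈Γ² : ∀ x y → Γ² (letter x · letter y)
letter-pair∈Γ² true  true  = gen-· SXS∈Γ² X∈Γ²
letter-pair∈Γ² true  false = gen-· SXS∈Γ² (gen-· X∈Γ² X∈Γ²)
letter-pair∈Γ² false true  = gen-neg (gen-· SXS∈Γ² (gen-· SXS∈Γ² X∈Γ²))
letter-pair∈Γ² false false = gen-neg (gen-· SXS∈Γ² (gen-· SXS∈Γ² (gen-· X∈Γ² X∈Γ²)))

even-word∈Γ² : ∀ {w} → EvenWord w → Γ² (eval w)
even-word∈Γ² []                   = gen-id
even-word∈Γ² (pair x y {w} even) =
  subst Γ² (·-assoc (letter x) (letter y) (eval w)) (gen-· (letter-pair∈Γ² x y) (even-word∈Γ² even))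

module _ {gs : List Mat} (Γ²⊆G : Γ² ⊆ Gen gs) where

  private
    G : Mat → Set
    G = Gen gs

  letter∈G⇒L,N∈G : ∀ x → G (letter x) → G Lm × G Nm
  letter∈G⇒L,N∈G true  L∈G = L∈G , gen-· L∈G (Γ²⊆G X∈Γ²)
  letter∈G⇒L,N∈G false N∈G = gen-· N∈G (gen-adj (Γ²⊆G X∈Γ²)) , N∈G

  odd-word⇒L,N∈G : ∀ {w} → Odd (length w) → G (eval w) → G Lm × G Nm
  odd-word⇒L,N∈G {w} odd w∈G with odd-length-split {w} odd
  ... | x , w′ , refl , even = letter∈G⇒L,N∈G x (subst G strip (gen-· w∈G (gen-adj (Γ²⊆G E∈Γ²))))
    where
    E∈Γ² = even-word∈Γ² even
    strip : (letter x · eval w′) · adj (eval w′) ≡ letter x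
    strip = begin
      (letter x · eval w′) · adj (eval w′)   ≡⟨ ·-assoc (letter x) (eval w′) (adj (eval w′)) ⟩
      letter x · (eval w′ · adj (eval w′))   ≡⟨ cong (letter x ·_) (adj-inverseʳ (eval w′) (Γ²⊆PSL E∈Γ²)) ⟩
      letter x · I                           ≡⟨ ·-identityʳ (letter x) ⟩
      letter x                               ∎
      where open ≡-Reasoning

-- Trees of words

data Tree : Set where
  leaf : Tree
  node : Tree → Tree → Tree

leaves : Tree → List (List Bool)
leaves leaf       = [ [] ]
leaves (node l r) = map (true ∷_) (leaves l) ++ map (false ∷_) (leaves r)

LeavesIn : (Mat → Set) → Mat → Tree → Set
LeavesIn G P leaf       = G P
LeavesIn G P (node l r) = LeavesIn G (P · Lm) l × LeavesIn G (P · Nm) r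

leaves⇒LeavesIn : ∀ {G : Mat → Set} t P → (∀ {w} → w ∈ leaves t → G (P · eval w)) → LeavesIn G P t
leaves⇒LeavesIn {G} leaf P P·w∈G = subst G (·-identityʳ P) (P·w∈G (here refl))
leaves⇒LeavesIn {G} (node l r) P P·w∈G =
  leaves⇒LeavesIn l (P · Lm) (λ {w} w∈l → subst G (sym (·-assoc P Lm (eval w)))
                                                 (P·w∈G (∈-++⁺ˡ (∈-map⁺ (true ∷_) w∈l)))) ,
  leaves⇒LeavesIn r (P · Nm) (λ {w} w∈r → subst G (sym (·-assoc P Nm (eval w)))
                                                 (P·w∈G (∈-++⁺ʳ (map (true ∷_) (leaves l)) (∈-map⁺ (false ∷_) w∈r))))

det-·-letter : ∀ P x → det P ≡ + 1 → det (P · letter x) ≡ + 1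
det-·-letter P true  det≡1 = trans (det-· P Lm) (trans (*-identityʳ (det P)) det≡1)
det-·-letter P false det≡1 = trans (det-· P Nm) (trans (*-identityʳ (det P)) det≡1)

module _ {gs : List Mat} where

  private
    G : Mat → Set
    G = Gen gs

  -- Two sibling leaves P L and P N give (P L)⁻¹ P N = X; a node with two leaf children
  -- is found by descending into any internal child.
  X∈⟨leaves⟩ : ∀ P l r → det P ≡ + 1 → LeavesIn G P (node l r) → G Xm
  X∈⟨leaves⟩ P leaf leaf det≡1 (PL∈G , PN∈G) =
    subst G (left-quotient-invariant P Lm Nm det≡1) (gen-· (gen-adj PL∈G) PN∈G)
  X∈⟨leaves⟩ P (node l₁ l₂) r det≡1 (left , _) = X∈⟨leaves⟩ (P · Lm) l₁ l₂ (det-·-letter P true det≡1) left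
  X∈⟨leaves⟩ P leaf (node r₁ r₂) det≡1 (_ , right) = X∈⟨leaves⟩ (P · Nm) r₁ r₂ (det-·-letter P false det≡1) right

  module _ (X∈G : G Xm) where

    PL⇒PS : ∀ P → G (P · Lm) → G (P · Sm)
    PL⇒PS P PL∈G = subst G (·-assoc P Lm (adj Xm)) (gen-· PL∈G (gen-adj X∈G))

    PN⇒PS : ∀ P → G (P · Nm) → G (P · Sm)
    PN⇒PS P PN∈G = subst G (·-assoc P Nm (adj (Xm · Xm))) (gen-· PN∈G (gen-adj (gen-· X∈G X∈G)))

    -- At an internal node P: a leaf child gives P S directly, and if both children are
    -- internal then (P L S)⁻¹ (P N S) = S⁻¹ X S.
    SXS-or-PS∈⟨leaves⟩ : ∀ P l r → det P ≡ + 1 → LeavesIn G P (node l r) → G SXS ⊎ G (P · Sm)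
    SXS-or-PS∈⟨leaves⟩ P leaf r _ (PL∈G , _) = inj₂ (PL⇒PS P PL∈G)
    SXS-or-PS∈⟨leaves⟩ P (node l₁ l₂) leaf _ (_ , PN∈G) = inj₂ (PN⇒PS P PN∈G)
    SXS-or-PS∈⟨leaves⟩ P (node l₁ l₂) (node r₁ r₂) det≡1 (left , right)
      with SXS-or-PS∈⟨leaves⟩ (P · Lm) l₁ l₂ (det-·-letter P true det≡1) left
         | SXS-or-PS∈⟨leaves⟩ (P · Nm) r₁ r₂ (det-·-letter P false det≡1) right
    ... | inj₁ SXS∈G | _          = inj₁ SXS∈G
    ... | inj₂ _     | inj₁ SXS∈G = inj₁ SXS∈G
    ... | inj₂ PLS∈G | inj₂ PNS∈G = inj₁ (gen-neg (subst G (left-quotient-invariant P (Lm · Sm) (Nm · Sm) det≡1)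
        (gen-· (gen-adj (subst G (·-assoc P Lm Sm) PLS∈G)) (subst G (·-assoc P Nm Sm) PNS∈G))))

  Γ²⊆⟨leaves⟩ : ∀ l r → LeavesIn G I (node l r) → Γ² ⊆ G
  Γ²⊆⟨leaves⟩ l r leaves∈G = Γ²⊆ X∈G SXS∈G
    where
    X∈G = X∈⟨leaves⟩ I l r refl leaves∈G
    SXS∈G : G SXS
    SXS∈G with SXS-or-PS∈⟨leaves⟩ X∈G I l r refl leaves∈G
    ... | inj₁ SXS∈G = SXS∈G
    ... | inj₂ S∈G   = gen-· (gen-· (subst G (·-identityˡ Sm) S∈G) X∈G) (subst G (·-identityˡ Sm) S∈G)

-- Unimodular tilings of [0 , ∞]

-- The indices of left a b c d and right a b c d are the entries of L · M and N · M
-- for M = (a b ; c d).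
data Shape : ℕ → ℕ → ℕ → ℕ → Set where
  identity : Shape 1 0 0 1
  left     : ∀ a b c d → a ℕ.* d ≡ suc (b ℕ.* c) → Shape a b (a ℕ.+ c) (b ℕ.+ d)
  right    : ∀ a b c d → a ℕ.* d ≡ suc (b ℕ.* c) → Shape (a ℕ.+ c) (b ℕ.+ d) c d

m≤n⇒∃[o]o+m≡n : ∀ {m n} → m ℕ.≤ n → Σ ℕ λ o → o ℕ.+ m ≡ n
m≤n⇒∃[o]o+m≡n {m} m≤n with ℕ.m≤n⇒∃[o]m+o≡n m≤n
... | o , m+o≡n = o , trans (ℕ.+-comm o m) m+o≡n

shape : ∀ a b c d → a ℕ.* d ≡ suc (b ℕ.* c) → Shape a b c d
shape a b c d det≡1 with a ℕ.≤? c | d ℕ.≤? b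
... | yes a≤c | yes d≤b = ⊥-elim (ℕ.1+n≰n (subst (ℕ._≤ b ℕ.* c) det≡1 ad≤bc))
  where
  ad≤bc : a ℕ.* d ℕ.≤ b ℕ.* c
  ad≤bc = subst (a ℕ.* d ℕ.≤_) (ℕ.*-comm c b) (ℕ.*-mono-≤ a≤c d≤b)
... | yes a≤c | no d≰b with ℕ.m≤n⇒∃[o]m+o≡n a≤c | ℕ.m≤n⇒∃[o]m+o≡n (ℕ.<⇒≤ (ℕ.≰⇒> d≰b))
...   | c′ , refl | d′ , refl =
  left a b c′ d′ (ℕ.+-cancelˡ-≡ (a ℕ.* b) _ _ (trans (expand a b d′) (trans det≡1 (expand′ a b c′))))
  where
  expand : ∀ a b d → a ℕ.* b ℕ.+ a ℕ.* d ≡ a ℕ.* (b ℕ.+ d)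
  expand = ℕ-Solver.solve-∀
  expand′ : ∀ a b c → suc (b ℕ.* (a ℕ.+ c)) ≡ a ℕ.* b ℕ.+ suc (b ℕ.* c)
  expand′ = ℕ-Solver.solve-∀
shape a b c d det≡1 | no a≰c | yes d≤b with m≤n⇒∃[o]o+m≡n (ℕ.<⇒≤ (ℕ.≰⇒> a≰c)) | m≤n⇒∃[o]o+m≡n d≤b
...   | a′ , refl | b′ , refl =
  right a′ b′ c d (ℕ.+-cancelˡ-≡ (c ℕ.* d) _ _ (trans (expand a′ c d) (trans det≡1 (expand′ b′ c d))))
  where
  expand : ∀ a c d → c ℕ.* d ℕ.+ a ℕ.* d ≡ (a ℕ.+ c) ℕ.* d
  expand = ℕ-Solver.solve-∀
  expand′ : ∀ b c d → suc ((b ℕ.+ d) ℕ.* c) ≡ c ℕ.* d ℕ.+ suc (b ℕ.* c)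
  expand′ = ℕ-Solver.solve-∀
-- c < a and b < d give (1 + c) (1 + b) ≤ a d = 1 + b c, forcing b = c = 0.
shape a b c d det≡1 | no a≰c | no d≰b with ℕ.m+n≡0⇒m≡0 b b+c≡0 | ℕ.m+n≡0⇒n≡0 b b+c≡0
  where
  expand : ∀ b c → suc c ℕ.* suc b ≡ suc (b ℕ.* c) ℕ.+ (b ℕ.+ c)
  expand = ℕ-Solver.solve-∀
  b+c≡0 : b ℕ.+ c ≡ 0
  b+c≡0 = ℕ.n≤0⇒n≡0 (ℕ.+-cancelˡ-≤ (suc (b ℕ.* c)) _ _
            (subst₂ ℕ._≤_ (expand b c) (trans det≡1 (sym (ℕ.+-identityʳ _))) (ℕ.*-mono-≤ (ℕ.≰⇒> a≰c) (ℕ.≰⇒> d≰b))))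
... | refl | refl with ℕ.m*n≡1⇒m≡1 a d det≡1 | ℕ.m*n≡1⇒n≡1 a d det≡1
...   | refl | refl = identity

-- Chain x Bs: the intervals B * [0 , ∞], B ∈ Bs, tile [x , ∞] in this order, all B nonnegative
-- of determinant 1; a point (p , q) stands for p / q in lowest terms.
data Chain (x : ℕ × ℕ) : List Mat → Set where
  done : x ≡ (1 , 0) → Chain x []
  step : ∀ {a b c d Bs} → a ℕ.* d ≡ suc (b ℕ.* c) → x ≡ (b , d) → Chain (a , c) Bs →
         Chain x (mat (+ a) (+ b) (+ c) (+ d) ∷ Bs)

L* N* : ℕ × ℕ → ℕ × ℕ
L* (p , q) = (p , p ℕ.+ q)
N* (p , q) = (p ℕ.+ q , q)

L*-injective : ∀ {x y} → L* x ≡ L* y → x ≡ y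
L*-injective {p , q} {r , s} eq with cong proj₁ eq
... | refl = cong (p ,_) (ℕ.+-cancelˡ-≡ p q s (cong proj₂ eq))

N*-injective : ∀ {x y} → N* x ≡ N* y → x ≡ y
N*-injective {p , q} {r , s} eq with cong proj₂ eq
... | refl = cong (_, q) (ℕ.+-cancelʳ-≡ q p r (cong proj₁ eq))

-- L * [0 , ∞] = [0 , 1] and N * [0 , ∞] = [1 , ∞] meet only in 1.
L*≡N*⇒ : ∀ {p q r s} → L* (p , q) ≡ N* (r , s) → r ≡ 0 × q ≡ 0
L*≡N*⇒ {p} {q} {r} {s} eq with cong proj₁ eq
... | refl = ℕ.m+n≡0⇒m≡0 r r+q≡0 , ℕ.m+n≡0⇒n≡0 r r+q≡0
  where
  rearrange : ∀ r s q → (r ℕ.+ q) ℕ.+ s ≡ (r ℕ.+ s) ℕ.+ q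
  rearrange = ℕ-Solver.solve-∀
  r+q≡0 : r ℕ.+ q ≡ 0
  r+q≡0 = ℕ.+-cancelʳ-≡ s (r ℕ.+ q) 0 (trans (rearrange r s q) (cong proj₂ eq))

chain-from-∞ : ∀ {Bs} → Chain (1 , 0) Bs → Bs ≡ []
chain-from-∞ (done _) = refl
chain-from-∞ (step {a} det≡1 refl _) = ⊥-elim (ℕ.0≢1+n (trans (sym (ℕ.*-zeroʳ a)) det≡1))

chain-from-0-nonempty : ¬ Chain (0 , 1) []
chain-from-0-nonempty (done ())

chain-above-1 : ∀ {y Bs} → Chain (N* y) Bs → Σ (List Mat) λ Ns → Bs ≡ map (Nm ·_) Ns × Chain y Ns
chain-above-1 {p , zero} (done eq) = [] , refl , done (cong (_, 0) (trans (sym (ℕ.+-identityʳ p)) (cong proj₁ eq)))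
chain-above-1 {p , suc q} (done ())
chain-above-1 {p , q} (step {a} {b} {c} {d} det≡1 eq ch) with shape a b c d det≡1
... | identity with cong proj₂ eq
...   | refl = ⊥-elim (ℕ.m+1+n≢0 p (cong proj₁ eq))
chain-above-1 {p , q} (step _ eq _) | left a b c d det′≡1 with L*≡N*⇒ {b} {d} {p} {q} (sym eq)
...   | _ , refl = ⊥-elim (ℕ.0≢1+n (trans (sym (ℕ.*-zeroʳ a)) det′≡1))
chain-above-1 {p , q} (step _ eq ch) | right a b c d det′≡1 with N*-injective {p , q} {b , d} eq
...   | refl with chain-above-1 ch
...     | Ns , refl , ch′ = (mat (+ a) (+ b) (+ c) (+ d) ∷ Ns) , cong (_∷ map (Nm ·_) Ns) (Nm·-expand (+ a) (+ b) (+ c) (+ d)) , step det′≡1 refl ch′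

chain-split-at-1 : ∀ {y Bs} → Chain (L* y) Bs →
         (y ≡ (0 , 1) × Bs ≡ [ I ])
         ⊎ Σ (List Mat) λ Ls → Σ (List Mat) λ Ns →
             Bs ≡ map (Lm ·_) Ls ++ map (Nm ·_) Ns × Chain y Ls × Chain (0 , 1) Ns
chain-split-at-1 {p , q} (done eq) with cong proj₁ eq
... | refl with cong proj₂ eq
...   | ()
chain-split-at-1 {p , q} (step {a} {b} {c} {d} det≡1 eq ch) with shape a b c d det≡1
... | identity with L*-injective {p , q} {0 , 1} eq
...   | refl = inj₁ (refl , cong (I ∷_) (chain-from-∞ ch))
chain-split-at-1 {p , q} (step _ eq ch) | left a b c d det′≡1 with L*-injective {p , q} {b , d} eq
...   | refl with chain-split-at-1 ch
...     | inj₁ (refl , _) = ⊥-elim (ℕ.0≢1+n det′≡1)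
...     | inj₂ (Ls , Ns , refl , chL , chN) =
  inj₂ (mat (+ a) (+ b) (+ c) (+ d) ∷ Ls , Ns , cong (_∷ _) (Lm·-expand (+ a) (+ b) (+ c) (+ d)) , step det′≡1 refl chL , chN)
chain-split-at-1 {p , q} chain@(step _ eq _) | right a b c d det′≡1 with L*≡N*⇒ {p} {q} {b} {d} eq
...   | refl , refl with ℕ.m*n≡1⇒m≡1 a d det′≡1 | ℕ.m*n≡1⇒n≡1 a d det′≡1
...     | refl | refl with cong proj₁ eq
...       | refl with chain-above-1 {0 , 1} chain
...         | Ns , Bs≡ , chN = inj₂ ([] , Ns , Bs≡ , done refl , chN)

private
  halves-shorter : ∀ {k} (xs ys : List Mat) → length (map (Lm ·_) xs ++ map (Nm ·_) ys) ℕ.≤ suc k →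
                   0 ℕ.< length xs → 0 ℕ.< length ys → length xs ℕ.≤ k × length ys ℕ.≤ k
  halves-shorter {k} xs ys |xs++ys|≤ 0<|xs| 0<|ys| =
    ℕ.s≤s⁻¹ (ℕ.<-≤-trans (ℕ.m<m+n (length xs) 0<|ys|) |xs|+|ys|≤) ,
    ℕ.s≤s⁻¹ (ℕ.<-≤-trans (ℕ.m<n+m (length ys) 0<|xs|) |xs|+|ys|≤)
    where
    |xs|+|ys|≤ : length xs ℕ.+ length ys ℕ.≤ suc k
    |xs|+|ys|≤ = subst (ℕ._≤ suc k)
                       (trans (length-++ (map (Lm ·_) xs)) (cong₂ ℕ._+_ (length-map (Lm ·_) xs) (length-map (Nm ·_) ys)))
                       |xs++ys|≤

eval-leaves-node : ∀ l r → map eval (leaves (node l r))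
                         ≡ map (Lm ·_) (map eval (leaves l)) ++ map (Nm ·_) (map eval (leaves r))
eval-leaves-node l r = begin
  map eval (map (true ∷_) (leaves l) ++ map (false ∷_) (leaves r))
    ≡⟨ map-++ eval (map (true ∷_) (leaves l)) (map (false ∷_) (leaves r)) ⟩
  map eval (map (true ∷_) (leaves l)) ++ map eval (map (false ∷_) (leaves r))
    ≡⟨ cong₂ _++_ (map-eval-∷ true (leaves l)) (map-eval-∷ false (leaves r)) ⟩
  map (Lm ·_) (map eval (leaves l)) ++ map (Nm ·_) (map eval (leaves r)) ∎
  where
  open ≡-Reasoning
  map-eval-∷ : ∀ x ws → map eval (map (x ∷_) ws) ≡ map (letter x ·_) (map eval ws)
  map-eval-∷ x ws = trans (sym (map-∘ ws)) (map-∘ ws)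

chain⇒tree : ∀ k Bs → length Bs ℕ.≤ k → Chain (0 , 1) Bs → Σ Tree λ t → map eval (leaves t) ≡ Bs
chain⇒tree zero    []      _  ch = ⊥-elim (chain-from-0-nonempty ch)
chain⇒tree (suc k) Bs |Bs|≤ ch with chain-split-at-1 {0 , 1} ch
... | inj₁ (_ , refl) = leaf , refl
... | inj₂ ([] , _ , _ , chL , _) = ⊥-elim (chain-from-0-nonempty chL)
... | inj₂ (_ , [] , _ , _ , chN) = ⊥-elim (chain-from-0-nonempty chN)
... | inj₂ (Ls@(_ ∷ _) , Ns@(_ ∷ _) , refl , chL , chN)
  with halves-shorter Ls Ns |Bs|≤ ℕ.z<s ℕ.z<s
...   | |Ls|≤k , |Ns|≤k with chain⇒tree k Ls |Ls|≤k chL | chain⇒tree k Ns |Ns|≤k chN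
...     | l , l≡Ls | r , r≡Ns =
  node l r , trans (eval-leaves-node l r) (cong₂ (λ u v → map (Lm ·_) u ++ map (Nm ·_) v) l≡Ls r≡Ns)

det≡1⇒ℕ : ∀ a b c d → det (mat (+ a) (+ b) (+ c) (+ d)) ≡ + 1 → a ℕ.* d ≡ suc (b ℕ.* c)
det≡1⇒ℕ a b c d det≡1 = +-injective (begin
  + (a ℕ.* d)                 ≡⟨ pos-* a d ⟩
  + a * + d                   ≡⟨ expand (+ a * + d) (+ b * + c) ⟩
  (+ a * + d - + b * + c) + + b * + c  ≡⟨ cong (_+ + b * + c) det≡1 ⟩
  + 1 + + b * + c             ≡⟨ cong (λ z → + 1 + z) (pos-* b c) ⟨
  + suc (b ℕ.* c)             ∎)
  where
  open ≡-Reasoning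
  expand : ∀ x y → x ≡ (x - y) + y
  expand = solve-∀

≈ₚ⇒ℕ : ∀ {p q r s} → (+ p , + q) ≈ₚ (+ r , + s) → p ℕ.* s ≡ q ℕ.* r
≈ₚ⇒ℕ {p} {q} {r} {s} eq = +-injective (trans (pos-* p s) (trans eq (sym (pos-* q r))))

det≡1⇒coprime-col₁ : ∀ {a b c d} → a ℕ.* d ≡ suc (b ℕ.* c) → Coprime a c
det≡1⇒coprime-col₁ {a} {b} {c} {d} det≡1 {i} (i∣a , i∣c) =
  ∣1⇒≡1 (∣m+n∣m⇒∣n (subst (i ∣_) (trans det≡1 (ℕ.+-comm 1 (b ℕ.* c))) (∣m⇒∣m*n d i∣a)) (∣n⇒∣m*n b i∣c))

det≡1⇒coprime-col₂ : ∀ {a b c d} → a ℕ.* d ≡ suc (b ℕ.* c) → Coprime b d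
det≡1⇒coprime-col₂ {a} {b} {c} {d} det≡1 =
  Coprime.sym (det≡1⇒coprime-col₁ {d} {c} {b} {a} (trans (ℕ.*-comm d a) (trans det≡1 (cong suc (ℕ.*-comm b c)))))

lowest-terms-unique : ∀ {p q r s} → Coprime p q → Coprime r s → p ℕ.* s ≡ q ℕ.* r → p ≡ r × q ≡ s
lowest-terms-unique {p} {q} {r} {s} cop₁ cop₂ ps≡qr =
  ∣-antisym (coprime-divisor cop₁ (subst (p ∣_) ps≡qr (m∣m*n s)))
            (coprime-divisor cop₂ (subst (r ∣_) (trans (sym ps≡qr) (ℕ.*-comm p s)) (n∣m*n q))) ,
  ∣-antisym (coprime-divisor (Coprime.sym cop₁) (subst (q ∣_) (sym ps≡qr) (m∣m*n r)))
            (coprime-divisor (Coprime.sym cop₂) (subst (s ∣_) (trans ps≡qr (ℕ.*-comm q r)) (n∣m*n p)))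

lo≡at0 : ∀ B → det B ≡ + 1 → lo B ≡ at0 B
lo≡at0 B det≡1 with det B ≟ + 1
... | yes _    = refl
... | no det≢1 = ⊥-elim (det≢1 det≡1)

hi≡atInf : ∀ B → det B ≡ + 1 → hi B ≡ atInf B
hi≡atInf B det≡1 with det B ≟ + 1
... | yes _    = refl
... | no det≢1 = ⊥-elim (det≢1 det≡1)

tiles⇒chain : ∀ {p q} Bs → Coprime p q → (∀ {B} → B ∈ Bs → NonNeg B × det B ≡ + 1) →
              Tiles (+ p , + q) Bs → Chain (p , q) Bs
tiles⇒chain {p} {q} [] cop _ p/q≈∞ = done (cong₂ _,_ p≡1 q≡0)
  where
  q≡0 : q ≡ 0
  q≡0 = trans (sym (ℕ.*-identityʳ q)) (trans (sym (≈ₚ⇒ℕ {p} {q} {1} {0} p/q≈∞)) (ℕ.*-zeroʳ p))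
  p≡1 : p ≡ 1
  p≡1 = cop (∣-refl , subst (p ∣_) (sym q≡0) (p ∣0))
tiles⇒chain {p} {q} (B@(mat _ _ _ _) ∷ Bs) cop unimodular (p/q≈lo , rest)
  with unimodular (here refl)
... | (+≤+ {n = a} _ , +≤+ {n = b} _ , +≤+ {n = c} _ , +≤+ {n = d} _) , det≡1 =
  step det≡1ℕ (cong₂ _,_ (proj₁ p≡b×q≡d) (proj₂ p≡b×q≡d))
       (tiles⇒chain Bs (det≡1⇒coprime-col₁ {a} {b} {c} {d} det≡1ℕ) (unimodular ∘ there)
                    (subst (λ x → Tiles x Bs) (hi≡atInf B det≡1) rest))
  where
  det≡1ℕ : a ℕ.* d ≡ suc (b ℕ.* c)
  det≡1ℕ = det≡1⇒ℕ a b c d det≡1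
  p≡b×q≡d : p ≡ b × q ≡ d
  p≡b×q≡d = lowest-terms-unique cop (det≡1⇒coprime-col₂ {a} {b} {c} {d} det≡1ℕ)
              (≈ₚ⇒ℕ {p} {q} {b} {d} (subst ((+ p , + q) ≈ₚ_) (lo≡at0 B det≡1) p/q≈lo))

-- The dichotomy

OddWord : Mat → Set
OddWord A = Σ (List Bool) λ w → eval w ≡ A × Odd (length w)

EvenWordFor : Mat → Set
EvenWordFor A = Σ (List Bool) λ w → eval w ≡ A × EvenWord w

positive-unit⇒det≡1 : ∀ {A} → IsUnit A → det A > + 0 → det A ≡ + 1
positive-unit⇒det≡1 (inj₁ det≡1) _ = det≡1
positive-unit⇒det≡1 (inj₂ det≡-1) 0<det with subst (+ 0 <_) det≡-1 0<det
... | ()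

slowCF-det≡1 : ∀ {As} → SlowCF As → (∀ {A} → A ∈ As → det A > + 0) → ∀ {A} → A ∈ As → det A ≡ + 1
slowCF-det≡1 (nonneg-unit , _) positive {A} A∈As = positive-unit⇒det≡1 {A} (proj₂ (nonneg-unit A∈As)) (positive A∈As)

slowCF⇒tree : ∀ As → SlowCF As → (∀ {A} → A ∈ As → det A ≡ + 1) →
              Σ Tree λ l → Σ Tree λ r → map eval (leaves (node l r)) ↭ As
slowCF⇒tree As (nonneg-unit , Bs , Bs↭As , 2≤|Bs| , tiles) det≡1
  with chain⇒tree (length Bs) Bs ℕ.≤-refl (tiles⇒chain Bs coprime-0-1 nonneg-unimodular tiles)
  where
  coprime-0-1 : Coprime 0 1
  coprime-0-1 (_ , d∣1) = ∣1⇒≡1 d∣1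
  nonneg-unimodular : ∀ {B} → B ∈ Bs → NonNeg B × det B ≡ + 1
  nonneg-unimodular B∈Bs = proj₁ (nonneg-unit (∈-resp-↭ Bs↭As B∈Bs)) , det≡1 (∈-resp-↭ Bs↭As B∈Bs)
... | leaf , refl with 2≤|Bs|
...   | s≤s ()
slowCF⇒tree As (_ , Bs , Bs↭As , _) _ | node l r , leaves≡Bs = l , r , subst (_↭ As) (sym leaves≡Bs) Bs↭As

odd-or-all-even : ∀ ws → Any (Odd ∘ length) ws ⊎ All EvenWord ws
odd-or-all-even []       = inj₂ []
odd-or-all-even (w ∷ ws) with odd-or-even w | odd-or-all-even ws
... | inj₁ odd  | _         = inj₁ (here odd)
... | inj₂ _    | inj₁ odd  = inj₁ (there odd)
... | inj₂ even | inj₂ even′ = inj₂ (even ∷ even′)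

module _ {gs : List Mat} where

  private
    G : Mat → Set
    G = Gen gs

  odd-or-even-generators : ∀ t → map eval (leaves t) ↭ gs → Any OddWord gs ⊎ All EvenWordFor gs
  odd-or-even-generators t leaves↭gs with odd-or-all-even (leaves t)
  ... | inj₁ odd with find odd
  ...   | w , w∈ , odd-w = inj₁ (lose (∈-resp-↭ leaves↭gs (∈-map⁺ eval w∈)) (w , refl , odd-w))
  odd-or-even-generators t leaves↭gs | inj₂ even = inj₂ (All.tabulate even-word)
    where
    even-word : ∀ {g} → g ∈ gs → EvenWordFor g
    even-word g∈gs with ∈-map⁻ eval (∈-resp-↭ (↭-sym leaves↭gs) g∈gs)
    ... | w , w∈ , refl = w , refl , All.lookup even w∈

  Γ²⊆⟨tree⟩ : ∀ l r → map eval (leaves (node l r)) ↭ gs → Γ² ⊆ G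
  Γ²⊆⟨tree⟩ l r leaves↭gs = Γ²⊆⟨leaves⟩ l r (leaves⇒LeavesIn (node l r) I leaf∈G)
    where
    leaf∈G : ∀ {w} → w ∈ leaves (node l r) → G (I · eval w)
    leaf∈G {w} w∈ = subst G (sym (·-identityˡ (eval w))) (gen-generator (∈-resp-↭ leaves↭gs (∈-map⁺ eval w∈)))

  odd-generator⇒PSL : (∀ {g} → g ∈ gs → det g ≡ + 1) → Γ² ⊆ G → Any OddWord gs → G ≐ InPSL
  odd-generator⇒PSL det≡1 Γ²⊆G odd with find odd
  ... | _ , g∈gs , w , refl , odd-w with odd-word⇒L,N∈G Γ²⊆G {w} odd-w (gen-generator g∈gs)
  ...   | L∈G , N∈G = λ M → gen-det det≡1 , PSL⊆⟨L,N⟩ L∈G N∈G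

  even-generators⇒Γ² : Γ² ⊆ G → All EvenWordFor gs → G ≐ Γ²
  even-generators⇒Γ² Γ²⊆G even M = gen-mono generator∈Γ² , Γ²⊆G
    where
    generator∈Γ² : ∀ {g} → g ∈ gs → Γ² g
    generator∈Γ² g∈gs with All.lookup even g∈gs
    ... | w , refl , even-w = even-word∈Γ² even-w

tree-generated-dichotomy : ∀ {gs} l r → map eval (leaves (node l r)) ↭ gs → (∀ {g} → g ∈ gs → det g ≡ + 1) →
                           ((Gen gs ≐ InPSL) ⊎ (Gen gs ≐ Γ²))
                           × ((Gen gs ≐ InPSL) → Any OddWord gs) × (Any OddWord gs → Gen gs ≐ InPSL)
tree-generated-dichotomy {gs} l r leaves↭gs det≡1 = PSL-or-Γ² , PSL⇒odd , odd⇒PSL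
  where
  Γ²⊆G : Γ² ⊆ Gen gs
  Γ²⊆G = Γ²⊆⟨tree⟩ l r leaves↭gs
  odd⇒PSL : Any OddWord gs → Gen gs ≐ InPSL
  odd⇒PSL = odd-generator⇒PSL det≡1 Γ²⊆G
  PSL-or-Γ² : (Gen gs ≐ InPSL) ⊎ (Gen gs ≐ Γ²)
  PSL-or-Γ² with odd-or-even-generators (node l r) leaves↭gs
  ... | inj₁ odd  = inj₁ (odd⇒PSL odd)
  ... | inj₂ even = inj₂ (even-generators⇒Γ² Γ²⊆G even)
  PSL⇒odd : Gen gs ≐ InPSL → Any OddWord gs
  PSL⇒odd G≐PSL with odd-or-even-generators (node l r) leaves↭gs
  ... | inj₁ odd  = odd
  ... | inj₂ even = ⊥-elim (S∉Γ² (proj₁ (even-generators⇒Γ² Γ²⊆G even Sm) (proj₂ (G≐PSL Sm) refl)))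

corollary4p3 : (As : List Mat) → SlowCF As → (∀ {A} → A ∈ As → det A > + 0) →
    ((ΣT As ≐ InPSL) ⊎ (ΣT As ≐ Gen (Rm ∷ Sm · Rm · Sm ∷ [])))
    × (((ΣT As ≐ InPSL) → Any (λ A → Σ (List Bool) (λ w → (eval w ≡ A) × Odd (length w))) As)
    × (Any (λ A → Σ (List Bool) (λ w → (eval w ≡ A) × Odd (length w))) As → (ΣT As ≐ InPSL)))
corollary4p3 As slowCF positive with slowCF⇒tree As slowCF (slowCF-det≡1 slowCF positive)
... | l , r , leaves↭As = tree-generated-dichotomy l r leaves↭As (slowCF-det≡1 slowCF positive)
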